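{- Let $q_1,\ldots,q_l$ be distinct odd primes, $e_1,\ldots,e_l$ positive integers, and $r$ a nonnegative integer such that $S_{q_i^{e_i}-1}\equiv r\pmod{q_i^{e_i}}$ for all $i=1,\ldots,l$. Then for $n=q_1^{e_1}\cdots q_l^{e_l}$ we have $S_{n-1}\equiv r\pmod n$. In particular, $S_{n-1}\equiv 0\pmod n$ if and only if $S_{q_i^{e_i}-1}\equiv 0\pmod{q_i^{e_i}}$ for all $i=1,\ldots,l$.
   Context: The derangement numbers are $S_k=k!\sum_{i=0}^{k}\frac{(-1)^i}{i!}$ for $k\ge 0$. -}

module Defs where

open import Data.Nat as ℕ using (ℕ; zero; suc; _!)
open import Data.Nat.Properties using (_!≢0)
open import Data.Nat.DivMod using (_/_)
open import Data.Integer as ℤ using (ℤ; +_; -_; _-_)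
open import Data.Integer.Divisibility using (_∣_)
open import Data.Vec.Functional using (Vector; foldr)

sgn : ℕ → ℤ
sgn zero = + 1
sgn (suc i) = - sgn i

-- Σ_{i=0}^{m} f i  (inclusive upper bound)
sumTo : ℕ → (ℕ → ℤ) → ℤ
sumTo zero f = f 0
sumTo (suc m) f = sumTo m f ℤ.+ f (suc m)

-- Derangement number S_k = k! Σ_{i=0}^{k} (-1)^i / i!
--   = Σ_{i=0}^{k} (-1)^i (k!/i!)   (k!/i! is an exact natural division for i ≤ k)
S : ℕ → ℤ
S k = sumTo k (λ i → sgn i ℤ.* (+ ((k !) / (i !)) {{i !≢0}}))

_≡_[mod_] : ℤ → ℤ → ℕ → Set
a ≡ b [mod n ] = (+ n) ∣ (a - b)

prodℕ : ∀ {l} → Vector ℕ l → ℕ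
prodℕ = foldr ℕ._*_ 1

module Submission where

-- The proof rests on the recurrence S(k+1) = (k+1)·S(k) + (-1)^(k+1).
-- Comparing it at k and at k + N, where N is an even multiple of m, gives
--   S(j+1+N) - S(j+1) = N·S(j+N) + (j+1)·(S(j+N) - S(j)),
-- so by induction on j the sequence S is periodic modulo m with period N.
-- If m ∣ n with m, n odd, then n - 1 = (m - 1) + (n - m) and n - m is an even
-- multiple of m, hence S(n-1) ≡ S(m-1) (mod m).
--
-- For n = ∏ qᵢ^eᵢ this congruence holds for every factor mᵢ = qᵢ^eᵢ.  The
-- factors are pairwise coprime (distinct primes), so a number divisible by
-- every mᵢ is divisible by n (Chinese remainder theorem for divisibility).
-- This lifts S(mᵢ-1) ≡ r (mod mᵢ) for all i to S(n-1) ≡ r (mod n); the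
-- converse for r = 0 is reduction modulo each mᵢ.

open import Defs
open import Data.Nat as ℕ using (ℕ; zero; suc; _+_; _^_; _∸_; _≤_; _%_; _!; z≤n; parity)
open import Data.Nat.Properties as ℕP using (_!≢0)
open import Data.Nat.DivMod using (_/_; *-/-assoc; n/n≡1; [m+n]%n≡m%n)
open import Data.Nat.Divisibility as ℕ∣ using (divides; m≤n⇒m!∣n!)
open import Data.Nat.Coprimality as Coprime using (Coprime; coprime-divisor)
open import Data.Nat.Primality using (Prime; prime⇒irreducible; ¬prime[1])
open import Data.Parity.Base as ℙ using (0ℙ; 1ℙ)
open import Data.Parity.Properties using (+-homo-+; *-homo-*)
open import Data.Fin using (Fin; zero; suc)
open import Data.Fin.Properties using (suc-injective)
open import Data.Integer as ℤ using (ℤ; +_; -_; _-_)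
open import Data.Integer.Properties as ℤP using (pos-+; pos-*)
import Data.Integer.Divisibility.Signed as ℤ∣
open import Data.Integer.Tactic.RingSolver using (solve-∀)
open import Data.Product using (_×_; _,_)
open import Data.Sum using (inj₁; inj₂)
open import Data.Empty using (⊥-elim)
open import Function using (_⇔_; mk⇔; _∘_)
open import Relation.Binary.PropositionalEquality

open ≡-Reasoning

sumTo-cong : ∀ m {f g : ℕ → ℤ} → (∀ {i} → i ≤ m → f i ≡ g i) → sumTo m f ≡ sumTo m g
sumTo-cong zero    f≗g = f≗g z≤n
sumTo-cong (suc m) f≗g =
  cong₂ ℤ._+_ (sumTo-cong m (f≗g ∘ ℕP.m≤n⇒m≤1+n)) (f≗g ℕP.≤-refl)

sumTo-*ˡ : ∀ m c (f : ℕ → ℤ) → sumTo m (λ i → c ℤ.* f i) ≡ c ℤ.* sumTo m f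
sumTo-*ˡ zero    c f = refl
sumTo-*ˡ (suc m) c f = begin
  sumTo m (λ i → c ℤ.* f i) ℤ.+ c ℤ.* f (suc m) ≡⟨ cong (ℤ._+ c ℤ.* f (suc m)) (sumTo-*ˡ m c f) ⟩
  c ℤ.* sumTo m f ℤ.+ c ℤ.* f (suc m)         ≡⟨ ℤP.*-distribˡ-+ c (sumTo m f) (f (suc m)) ⟨
  c ℤ.* (sumTo m f ℤ.+ f (suc m))             ∎

sgn-even : ∀ N → parity N ≡ 0ℙ → sgn N ≡ + 1
sgn-even zero          _      = refl
sgn-even (suc zero)    ()
sgn-even (suc (suc N)) N-even = trans (ℤP.neg-involutive (sgn N)) (sgn-even N N-even)

sgn-+ : ∀ j N → sgn (j + N) ≡ sgn j ℤ.* sgn N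
sgn-+ zero    N = sym (ℤP.*-identityˡ (sgn N))
sgn-+ (suc j) N = trans (cong -_ (sgn-+ j N)) (ℤP.neg-distribˡ-* (sgn j) (sgn N))

sgn-shift : ∀ {N} → parity N ≡ 0ℙ → ∀ j → sgn (j + N) ≡ sgn j
sgn-shift {N} N-even j = begin
  sgn (j + N)        ≡⟨ sgn-+ j N ⟩
  sgn j ℤ.* sgn N    ≡⟨ cong (sgn j ℤ.*_) (sgn-even N N-even) ⟩
  sgn j ℤ.* + 1      ≡⟨ ℤP.*-identityʳ (sgn j) ⟩
  sgn j              ∎

-- The derangement recurrence S(k+1) = (k+1)·S(k) + (-1)^(k+1): the first
-- k+1 summands of S(k+1) are (k+1) times those of S(k), the last one is ±1.
S-step : ∀ k → S (suc k) ≡ + suc k ℤ.* S k ℤ.+ sgn (suc k)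
S-step k = cong₂ ℤ._+_ old-terms last-term
  where
  ratio : ℕ → ℕ → ℕ
  ratio j i = (j ! / i !) {{i !≢0}}

  -- (k+1)!/i! = (k+1)·(k!/i!) because i! ∣ k! for i ≤ k
  scaled : ∀ {i} → i ≤ k → sgn i ℤ.* + ratio (suc k) i ≡ + suc k ℤ.* (sgn i ℤ.* + ratio k i)
  scaled {i} i≤k = begin
    sgn i ℤ.* + ratio (suc k) i            ≡⟨ cong (λ x → sgn i ℤ.* + x) (*-/-assoc (suc k) {{i !≢0}} (m≤n⇒m!∣n! i≤k)) ⟩
    sgn i ℤ.* + (suc k ℕ.* ratio k i)      ≡⟨ cong (sgn i ℤ.*_) (pos-* (suc k) (ratio k i)) ⟩
    sgn i ℤ.* (+ suc k ℤ.* + ratio k i)    ≡⟨ left-commute (sgn i) (+ suc k) (+ ratio k i) ⟩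
    + suc k ℤ.* (sgn i ℤ.* + ratio k i)    ∎
    where
    left-commute : ∀ a b c → a ℤ.* (b ℤ.* c) ≡ b ℤ.* (a ℤ.* c)
    left-commute = solve-∀

  old-terms : sumTo k (λ i → sgn i ℤ.* + ratio (suc k) i) ≡ + suc k ℤ.* S k
  old-terms = trans (sumTo-cong k scaled) (sumTo-*ˡ k (+ suc k) (λ i → sgn i ℤ.* + ratio k i))

  last-term : sgn (suc k) ℤ.* + ratio (suc k) (suc k) ≡ sgn (suc k)
  last-term = trans (cong (λ x → sgn (suc k) ℤ.* + x) (n/n≡1 (suc k !) {{suc k !≢0}}))
                    (ℤP.*-identityʳ (sgn (suc k)))

-- Congruence modulo m unfolds to unsigned divisibility; the signed version
-- has the algebraic closure lemmas, so we pass between the two.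
≡mod⇒∣ : ∀ {m} a b → a ≡ b [mod m ] → + m ℤ∣.∣ (a - b)
≡mod⇒∣ {m} a b = ℤ∣.∣ᵤ⇒∣ {+ m} {a - b}

∣⇒≡mod : ∀ {m} a b → + m ℤ∣.∣ (a - b) → a ≡ b [mod m ]
∣⇒≡mod a b = ℤ∣.∣⇒∣ᵤ

≡mod-trans : ∀ {m} a b c → a ≡ b [mod m ] → b ≡ c [mod m ] → a ≡ c [mod m ]
≡mod-trans {m} a b c a≡b b≡c =
  ∣⇒≡mod a c (subst (+ m ℤ∣.∣_) (telescope a b c) (ℤ∣.∣m∣n⇒∣m+n (≡mod⇒∣ a b a≡b) (≡mod⇒∣ b c b≡c)))
  where
  telescope : ∀ a b c → (a - b) ℤ.+ (b - c) ≡ a - c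
  telescope = solve-∀

≡mod-sym : ∀ {m} a b → a ≡ b [mod m ] → b ≡ a [mod m ]
≡mod-sym {m} a b a≡b = ∣⇒≡mod b a (subst (+ m ℤ∣.∣_) (negate-difference a b) (ℤ∣.∣m⇒∣-m (≡mod⇒∣ a b a≡b)))
  where
  negate-difference : ∀ a b → - (a - b) ≡ b - a
  negate-difference = solve-∀

-- Base case of periodicity: S(N) ≡ S(0) = 1 (mod m) when m ∣ N and N is even,
-- since S(N) - 1 = N·S(N-1) by the recurrence.
S-even-multiple : ∀ {m} N → m ℕ∣.∣ N → parity N ≡ 0ℙ → + m ℤ∣.∣ (S N - S 0)
S-even-multiple     zero    _   _      = ℤ∣.divides (+ 0) refl
S-even-multiple {m} (suc k) m∣N N-even = subst (+ m ℤ∣.∣_) (sym difference)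
  (ℤ∣.∣m⇒∣m*n (S k) (ℤ∣.∣ᵤ⇒∣ {+ m} {+ suc k} m∣N))
  where
  cancel : ∀ x y → (x ℤ.+ y) - y ≡ x
  cancel = solve-∀

  difference : S (suc k) - + 1 ≡ + suc k ℤ.* S k
  difference = begin
    S (suc k) - + 1                          ≡⟨ cong (_- + 1) (S-step k) ⟩
    (+ suc k ℤ.* S k ℤ.+ sgn (suc k)) - + 1  ≡⟨ cong (λ s → (+ suc k ℤ.* S k ℤ.+ s) - + 1) (sgn-even (suc k) N-even) ⟩
    (+ suc k ℤ.* S k ℤ.+ + 1) - + 1          ≡⟨ cancel (+ suc k ℤ.* S k) (+ 1) ⟩
    + suc k ℤ.* S k                          ∎

S-periodic : ∀ {m N} → m ℕ∣.∣ N → parity N ≡ 0ℙ → ∀ j → S (j + N) ≡ S j [mod m ]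
S-periodic {m} {N} m∣N N-even j = ∣⇒≡mod (S (j + N)) (S j) (periodic j)
  where
  shifted-recurrence : ∀ a b x y s → ((a ℤ.+ b) ℤ.* x ℤ.+ s) - (a ℤ.* y ℤ.+ s) ≡ b ℤ.* x ℤ.+ a ℤ.* (x - y)
  shifted-recurrence = solve-∀

  -- subtracting the recurrence at j from the one at j + N
  step : ∀ j → S (suc j + N) - S (suc j) ≡ + N ℤ.* S (j + N) ℤ.+ + suc j ℤ.* (S (j + N) - S j)
  step j = begin
    S (suc (j + N)) - S (suc j)
      ≡⟨ cong₂ _-_ (S-step (j + N)) (S-step j) ⟩
    (+ suc (j + N) ℤ.* S (j + N) ℤ.+ sgn (suc j + N)) - (+ suc j ℤ.* S j ℤ.+ sgn (suc j))
      ≡⟨ cong₂ (λ a s → (a ℤ.* S (j + N) ℤ.+ s) - (+ suc j ℤ.* S j ℤ.+ sgn (suc j)))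
               (pos-+ (suc j) N) (sgn-shift N-even (suc j)) ⟩
    ((+ suc j ℤ.+ + N) ℤ.* S (j + N) ℤ.+ sgn (suc j)) - (+ suc j ℤ.* S j ℤ.+ sgn (suc j))
      ≡⟨ shifted-recurrence (+ suc j) (+ N) (S (j + N)) (S j) (sgn (suc j)) ⟩
    + N ℤ.* S (j + N) ℤ.+ + suc j ℤ.* (S (j + N) - S j)
      ∎

  periodic : ∀ j → + m ℤ∣.∣ (S (j + N) - S j)
  periodic zero    = S-even-multiple N m∣N N-even
  periodic (suc j) = subst (+ m ℤ∣.∣_) (sym (step j))
    (ℤ∣.∣m∣n⇒∣m+n (ℤ∣.∣m⇒∣m*n (S (j + N)) (ℤ∣.∣ᵤ⇒∣ {+ m} {+ N} m∣N))
                  (ℤ∣.∣n⇒∣m*n (+ suc j) (periodic j)))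

Odd : ℕ → Set
Odd n = parity n ≡ 1ℙ

%2≡1⇒odd : ∀ n → n % 2 ≡ 1 → Odd n
%2≡1⇒odd zero          ()
%2≡1⇒odd (suc zero)    _     = refl
%2≡1⇒odd (suc (suc n)) n+2%2 =
  %2≡1⇒odd n (trans (sym ([m+n]%n≡m%n n 2)) (trans (cong (_% 2) (ℕP.+-comm n 2)) n+2%2))

odd-* : ∀ a b → Odd a → Odd b → Odd (a ℕ.* b)
odd-* a b a-odd b-odd = trans (*-homo-* a b) (cong₂ ℙ._*_ a-odd b-odd)

odd-^ : ∀ a e → Odd a → Odd (a ^ e)
odd-^ a zero    _     = refl
odd-^ a (suc e) a-odd = odd-* a (a ^ e) a-odd (odd-^ a e a-odd)

odd-prodℕ : ∀ {l} (f : Fin l → ℕ) → (∀ i → Odd (f i)) → Odd (prodℕ f)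
odd-prodℕ {zero}  f _     = refl
odd-prodℕ {suc l} f f-odd = odd-* (f zero) (prodℕ (f ∘ suc)) (f-odd zero) (odd-prodℕ (f ∘ suc) (f-odd ∘ suc))

odd-difference : ∀ N m → Odd m → Odd (N + m) → parity N ≡ 0ℙ
odd-difference N m m-odd N+m-odd = cancel-1ℙ (parity N) (begin
  parity N ℙ.+ 1ℙ          ≡⟨ cong (parity N ℙ.+_) m-odd ⟨
  parity N ℙ.+ parity m    ≡⟨ +-homo-+ N m ⟨
  parity (N + m)           ≡⟨ N+m-odd ⟩
  1ℙ                       ∎)
  where
  cancel-1ℙ : ∀ p → p ℙ.+ 1ℙ ≡ 1ℙ → p ≡ 0ℙ
  cancel-1ℙ 0ℙ _ = refl
  cancel-1ℙ 1ℙ ()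

-- The key congruence: if m ∣ n with m and n odd then S(n-1) ≡ S(m-1) (mod m),
-- since n - 1 = (m - 1) + N where N = n - m is an even multiple of m.
S-odd-divisor : ∀ {m n} → Odd m → Odd n → m ℕ∣.∣ n → S (n ∸ 1) ≡ S (m ∸ 1) [mod m ]
S-odd-divisor {zero}   ()
S-odd-divisor {suc m′} {zero}   _     ()
S-odd-divisor {suc m′} {suc n′} m-odd n-odd m∣n =
  subst (λ k → S k ≡ S m′ [mod suc m′ ]) n′≡m′+N (S-periodic m∣N N-even m′)
  where
  N : ℕ
  N = suc n′ ∸ suc m′

  n≡N+m : suc n′ ≡ N + suc m′
  n≡N+m = sym (ℕP.m∸n+n≡m (ℕ∣.∣⇒≤ m∣n))

  n′≡m′+N : m′ + N ≡ n′
  n′≡m′+N = ℕP.suc-injective (begin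
    suc (m′ + N)   ≡⟨ cong suc (ℕP.+-comm m′ N) ⟩
    suc (N + m′)   ≡⟨ ℕP.+-suc N m′ ⟨
    N + suc m′     ≡⟨ n≡N+m ⟨
    suc n′         ∎)

  m∣N : suc m′ ℕ∣.∣ N
  m∣N = ℕ∣.∣m+n∣m⇒∣n (subst (suc m′ ℕ∣.∣_) (trans n≡N+m (ℕP.+-comm N (suc m′))) m∣n) ℕ∣.∣-refl

  N-even : parity N ≡ 0ℙ
  N-even = odd-difference N (suc m′) m-odd (subst Odd n≡N+m n-odd)

factor∣prodℕ : ∀ {l} (f : Fin l → ℕ) i → f i ℕ∣.∣ prodℕ f
factor∣prodℕ f zero    = ℕ∣.m∣m*n (prodℕ (f ∘ suc))
factor∣prodℕ f (suc i) = ℕ∣.∣n⇒∣m*n (f zero) (factor∣prodℕ (f ∘ suc) i)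

coprime-*ʳ : ∀ {a b c} → Coprime a b → Coprime a c → Coprime a (b ℕ.* c)
coprime-*ʳ a⊥b a⊥c (d∣a , d∣bc) =
  a⊥c (d∣a , coprime-divisor (λ (x∣d , x∣b) → a⊥b (ℕ∣.∣-trans x∣d d∣a , x∣b)) d∣bc)

coprime-^ʳ : ∀ {a b} e → Coprime a b → Coprime a (b ^ e)
coprime-^ʳ zero    _   (_ , d∣1) = ℕ∣.∣1⇒≡1 d∣1
coprime-^ʳ (suc e) a⊥b = coprime-*ʳ a⊥b (coprime-^ʳ e a⊥b)

coprime-^ : ∀ {a b} e f → Coprime a b → Coprime (a ^ e) (b ^ f)
coprime-^ e f a⊥b = Coprime.sym (coprime-^ʳ e (Coprime.sym (coprime-^ʳ f a⊥b)))

primes-coprime : ∀ {p q} → Prime p → Prime q → p ≢ q → Coprime p q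
primes-coprime p-prime q-prime p≢q (d∣p , d∣q) with prime⇒irreducible q-prime d∣q
... | inj₁ d≡1 = d≡1
... | inj₂ refl with prime⇒irreducible p-prime d∣p
...   | inj₁ refl = ⊥-elim (¬prime[1] q-prime)
...   | inj₂ q≡p  = ⊥-elim (p≢q (sym q≡p))

coprime-prodℕ : ∀ {a l} (f : Fin l → ℕ) → (∀ i → Coprime a (f i)) → Coprime a (prodℕ f)
coprime-prodℕ {l = zero}  f _    (_ , d∣1) = ℕ∣.∣1⇒≡1 d∣1
coprime-prodℕ {l = suc l} f a⊥f = coprime-*ʳ (a⊥f zero) (coprime-prodℕ (f ∘ suc) (a⊥f ∘ suc))

coprime-∣ : ∀ {a b x} → Coprime a b → a ℕ∣.∣ x → b ℕ∣.∣ x → a ℕ.* b ℕ∣.∣ x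
coprime-∣ {a} {b} a⊥b a∣x (divides y refl)
  with coprime-divisor a⊥b (subst (a ℕ∣.∣_) (ℕP.*-comm y b) a∣x)
... | divides z refl = divides z (ℕP.*-assoc z a b)

prodℕ∣ : ∀ {l x} (f : Fin l → ℕ) → (∀ i j → i ≢ j → Coprime (f i) (f j)) →
  (∀ i → f i ℕ∣.∣ x) → prodℕ f ℕ∣.∣ x
prodℕ∣ {zero}  {x} f _        _   = ℕ∣.1∣ x
prodℕ∣ {suc l}     f pairwise f∣x = coprime-∣
  (coprime-prodℕ (f ∘ suc) (λ i → pairwise zero (suc i) (λ ())))
  (f∣x zero)
  (prodℕ∣ (f ∘ suc) (λ i j i≢j → pairwise (suc i) (suc j) (i≢j ∘ suc-injective)) (f∣x ∘ suc))

-- Corollary 2: for n = ∏ qᵢ^eᵢ with distinct odd primes qᵢ, the congruences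
-- S(qᵢ^eᵢ - 1) ≡ r (mod qᵢ^eᵢ) imply S(n-1) ≡ r (mod n), and for r = 0 the
-- converse holds as well.
corollary2 : (l : ℕ) (q e : Fin l → ℕ) (r : ℕ) →
  (∀ i → Prime (q i)) → (∀ i → q i % 2 ≡ 1) →
  (∀ i j → q i ≡ q j → i ≡ j) → (∀ i → 1 ≤ e i) →
  ((∀ i → S (q i ^ e i ∸ 1) ≡ + r [mod q i ^ e i ]) →
    S (prodℕ (λ i → q i ^ e i) ∸ 1) ≡ + r [mod prodℕ (λ i → q i ^ e i) ])
  × ((S (prodℕ (λ i → q i ^ e i) ∸ 1) ≡ + 0 [mod prodℕ (λ i → q i ^ e i) ])
    ⇔ (∀ i → S (q i ^ e i ∸ 1) ≡ + 0 [mod q i ^ e i ]))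
corollary2 l q e r q-prime q-odd q-injective _ = lift r , mk⇔ restrict (lift 0)
  where
  m : Fin l → ℕ
  m i = q i ^ e i

  n : ℕ
  n = prodℕ m

  m-odd : ∀ i → Odd (m i)
  m-odd i = odd-^ (q i) (e i) (%2≡1⇒odd (q i) (q-odd i))

  reduce : ∀ i → S (n ∸ 1) ≡ S (m i ∸ 1) [mod m i ]
  reduce i = S-odd-divisor (m-odd i) (odd-prodℕ m m-odd) (factor∣prodℕ m i)

  m-coprime : ∀ i j → i ≢ j → Coprime (m i) (m j)
  m-coprime i j i≢j = coprime-^ (e i) (e j) (primes-coprime (q-prime i) (q-prime j) (i≢j ∘ q-injective i j))

  -- a congruence modulo n is divisibility of a difference by n, so the CRT applies
  lift : ∀ r → (∀ i → S (m i ∸ 1) ≡ + r [mod m i ]) → S (n ∸ 1) ≡ + r [mod n ]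
  lift r hyp = prodℕ∣ m m-coprime (λ i → ≡mod-trans (S (n ∸ 1)) (S (m i ∸ 1)) (+ r) (reduce i) (hyp i))

  restrict : S (n ∸ 1) ≡ + 0 [mod n ] → ∀ i → S (m i ∸ 1) ≡ + 0 [mod m i ]
  restrict n∣S i = ≡mod-trans (S (m i ∸ 1)) (S (n ∸ 1)) (+ 0)
    (≡mod-sym (S (n ∸ 1)) (S (m i ∸ 1)) (reduce i))
    (ℕ∣.∣-trans (factor∣prodℕ m i) n∣S)
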